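{- Let $G$ be a linear-convex supergrid graph and let $v=(v_x,v_y)$ be a vertex of $G$. If both $(v_x-1,v_y-1)$ and $(v_x+1,v_y-1)$ are vertices of $G$, then $(v_x,v_y-1)$ is a vertex of $G$. Likewise: if $(v_x-1,v_y-1)$ and $(v_x-1,v_y+1)$ are in $G$, then $(v_x-1,v_y)$ is in $G$; if $(v_x+1,v_y-1)$ and $(v_x+1,v_y+1)$ are in $G$, then $(v_x+1,v_y)$ is in $G$; and if $(v_x-1,v_y+1)$ and $(v_x+1,v_y+1)$ are in $G$, then $(v_x,v_y+1)$ is in $G$.
   Context: The two-dimensional supergrid $S^\infty$ is the infinite graph whose vertex set is $\mathbb{Z}^2$, in which two distinct vertices $(a,b)$ and $(c,d)$ are adjacent if and only if $|a-c|\le 1$ and $|b-d|\le 1$ (so each vertex has eight neighbours: horizontal, vertical and diagonal). A supergrid graph is a finite vertex-induced subgraph of $S^\infty$. A supergrid graph $G$ is linear-convex (linearly convex) if for every line $l$ in the plane that contains an edge of $S^\infty$ (i.e. every horizontal, vertical, slope $+1$ or slope $-1$ line through integer points), the intersection of $l$ with $G$ is either empty, a single vertex, or a line segment forming a path of $G$; equivalently, the vertices of $G$ lying on $l$ form a (possibly empty) set of consecutive lattice points of $l$. -}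

module Defs where

open import Data.Integer using (ℤ; +_; _+_; _*_; -_)
open import Data.Nat as ℕ using (ℕ)
open import Data.Product using (_×_; _,_)
open import Data.List using (List)
open import Data.List.Membership.Propositional using (_∈_)

Point : Set
Point = ℤ × ℤ

-- A supergrid graph: a finite vertex-induced subgraph of the supergrid S^∞.
-- Being vertex-induced, it is determined by its finite vertex set,
-- which we represent as a list of lattice points.
SupergridGraph : Set
SupergridGraph = List Point

_∈V_ : Point → SupergridGraph → Set
p ∈V G = p ∈ G

-- The four edge directions of S^∞: horizontal, vertical, slope +1, slope -1.
-- Every line containing an edge of S^∞ is { p + t·d | t ∈ Z } for some
-- lattice point p and one of these directions d.
data Direction : Set where
  horiz vert diag antidiag : Direction

vec : Direction → Point
vec horiz    = (+ 1 , + 0)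
vec vert     = (+ 0 , + 1)
vec diag     = (+ 1 , + 1)
vec antidiag = (+ 1 , - (+ 1))

step : Point → ℤ → Direction → Point
step (x , y) t d with vec d
... | (dx , dy) = (x + t * dx , y + t * dy)

-- Linear convexity: on every line l of S^∞, the vertices of G on l form a
-- set of consecutive lattice points of l.
LinearConvex : SupergridGraph → Set
LinearConvex G =
  ∀ (d : Direction) (p : Point) (k j : ℕ) → j ℕ.≤ k →
  p ∈V G → step p (+ k) d ∈V G → step p (+ j) d ∈V G

module Submission where

open import Defs
open import Data.Integer using (ℤ; _+_; _-_; +_; _*_)
open import Data.Integer.Tactic.RingSolver using (solve-∀)
open import Data.Nat using (s≤s; z≤n)
open import Data.Product using (_×_; _,_)
open import Relation.Binary.PropositionalEquality using (_≡_; sym; subst; cong₂)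

∈V-resp-≡ : ∀ {G p q} → p ≡ q → p ∈V G → q ∈V G
∈V-resp-≡ {G} = subst (_∈V G)

midpoint-∈V : ∀ {G} → LinearConvex G → ∀ d p →
  p ∈V G → step p (+ 2) d ∈V G → step p (+ 1) d ∈V G
midpoint-∈V convex d p = convex d p 2 1 (s≤s z≤n)

private
  -1+2≡+1 : ∀ v → v - + 1 + + 2 * + 1 ≡ v + + 1
  -1+2≡+1 = solve-∀

  -1+1≡id : ∀ v → v - + 1 + + 1 * + 1 ≡ v
  -1+1≡id = solve-∀

  +2·0≡id : ∀ v → v + + 2 * + 0 ≡ v
  +2·0≡id = solve-∀

  +1·0≡id : ∀ v → v + + 1 * + 0 ≡ v
  +1·0≡id = solve-∀

horizontal-midpoint-∈V : ∀ {G} → LinearConvex G → ∀ x y →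
  (x - + 1 , y) ∈V G → (x + + 1 , y) ∈V G → (x , y) ∈V G
horizontal-midpoint-∈V convex x y left right =
  ∈V-resp-≡ (cong₂ _,_ (-1+1≡id x) (+1·0≡id y))
    (midpoint-∈V convex horiz (x - + 1 , y) left
      (∈V-resp-≡ (sym (cong₂ _,_ (-1+2≡+1 x) (+2·0≡id y))) right))

vertical-midpoint-∈V : ∀ {G} → LinearConvex G → ∀ x y →
  (x , y - + 1) ∈V G → (x , y + + 1) ∈V G → (x , y) ∈V G
vertical-midpoint-∈V convex x y below above =
  ∈V-resp-≡ (cong₂ _,_ (+1·0≡id x) (-1+1≡id y))
    (midpoint-∈V convex vert (x , y - + 1) below
      (∈V-resp-≡ (sym (cong₂ _,_ (+2·0≡id x) (-1+2≡+1 y))) above))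

proposition5 : (G : SupergridGraph) → LinearConvex G →
    (vx vy : ℤ) → (vx , vy) ∈V G →
    (((vx - + 1 , vy - + 1) ∈V G → (vx + + 1 , vy - + 1) ∈V G → (vx , vy - + 1) ∈V G)
    × ((vx - + 1 , vy - + 1) ∈V G → (vx - + 1 , vy + + 1) ∈V G → (vx - + 1 , vy) ∈V G)
    × ((vx + + 1 , vy - + 1) ∈V G → (vx + + 1 , vy + + 1) ∈V G → (vx + + 1 , vy) ∈V G)
    × ((vx - + 1 , vy + + 1) ∈V G → (vx + + 1 , vy + + 1) ∈V G → (vx , vy + + 1) ∈V G))
proposition5 G convex vx vy _ =
    horizontal-midpoint-∈V convex vx (vy - + 1)
  , vertical-midpoint-∈V convex (vx - + 1) vy
  , vertical-midpoint-∈V convex (vx + + 1) vy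
  , horizontal-midpoint-∈V convex vx (vy + + 1)
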